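{- Let $D=(V,\mathcal{B})$ be a symmetric $(v,k,\lambda)$ design and let $\alpha$ be an automorphism of $D$ of prime order $p$ with $1<\lambda<p$. Then $B\not\subseteq F(\alpha)$ for every block $B\in\mathcal{B}$.
   Context: A symmetric $(v,k,\lambda)$ design, for integers $v>k>\lambda\geq 0$, is a pair $D=(V,\mathcal{B})$ where $V$ is a set of $v$ points and $\mathcal{B}$ is a set of $k$-subsets of $V$ (blocks) such that $|\mathcal{B}|=v$, every point lies in exactly $k$ blocks, any two distinct blocks meet in exactly $\lambda$ points, and any two distinct points lie in exactly $\lambda$ common blocks. An automorphism of $D$ is a permutation of $V$ mapping blocks to blocks. For an automorphism $\alpha$, $F(\alpha)$ denotes the set of points fixed by $\alpha$. -}

module Defs where

open import Data.Nat using (ℕ; zero; suc; _<_)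
open import Data.Fin using (Fin)
open import Data.Fin.Subset using (Subset; _∈_; _∉_; _∩_; ∣_∣; _⊆_)
open import Data.Fin.Subset.Properties using (_∈?_)
open import Data.List using (filter)
open import Data.List.Base using (length)
open import Data.Fin.Base using ()
open import Data.List.Base using (List)
open import Data.Fin.Properties using ()
open import Data.Product using (Σ; ∃; _×_; _,_)
open import Function using (_∘_; _⇔_)
open import Function.Definitions using (Injective; Bijective)
open import Relation.Binary.PropositionalEquality using (_≡_; _≢_)
open import Relation.Nullary using (¬_)
open import Relation.Nullary.Decidable using (_×-dec_)
open import Data.List.Base using (allFin)

-- A design on point set Fin v whose blocks are indexed by Fin v
-- (|B| = v); the block family is injective, so the v blocks are distinct.
-- Number of blocks containing both points x and y.
blocksThrough : {v : ℕ} → (Fin v → Subset v) → Fin v → Fin v → ℕ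
blocksThrough {v} B x y =
  length (filter (λ i → (x ∈? B i) ×-dec (y ∈? B i)) (allFin v))

blocksThrough₁ : {v : ℕ} → (Fin v → Subset v) → Fin v → ℕ
blocksThrough₁ {v} B x = length (filter (λ i → x ∈? B i) (allFin v))

record IsSymmetricDesign (v k lam : ℕ) (B : Fin v → Subset v) : Set where
  field
    k<v          : k < v
    lam<k        : lam < k
    blocks-distinct : Injective _≡_ _≡_ B
    block-size   : ∀ i → ∣ B i ∣ ≡ k
    replication  : ∀ x → blocksThrough₁ B x ≡ k
    block-inter  : ∀ i j → i ≢ j → ∣ B i ∩ B j ∣ ≡ lam
    pair-count   : ∀ x y → x ≢ y → blocksThrough B x y ≡ lam

IsAutomorphism : {v : ℕ} → (Fin v → Subset v) → (Fin v → Fin v) → Set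
IsAutomorphism {v} B α =
  Bijective _≡_ _≡_ α ×
  (∀ i → ∃ λ j → ∀ y → (y ∈ B i ⇔ α y ∈ B j))

iter : {A : Set} → ℕ → (A → A) → A → A
iter zero    f = λ a → a
iter (suc n) f = f ∘ iter n f

HasOrder : {v : ℕ} → (Fin v → Fin v) → ℕ → Set
HasOrder {v} α n =
  (∀ x → iter n α x ≡ x) ×
  (∀ m → 0 < m → m < n → ¬ (∀ x → iter m α x ≡ x))

-- F(α): the set of points fixed by α, as a predicate; B ⊆ F(α).
BlockFixedPointwise : {v : ℕ} → (Fin v → Fin v) → Subset v → Set
BlockFixedPointwise α S = ∀ x → x ∈ S → α x ≡ x

module Submission where

-- An automorphism α permutes the blocks; call the induced
-- block permutation σ.  Since α^p = id and the blocks are distinct, σ^p = id,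
-- and for the prime p every σ-orbit has length 1 or p: a point whose orbit
-- fits into fewer than p elements is fixed (Bézout with 0 < e < p).
-- Suppose the block B i₀ is fixed pointwise by α.  For two distinct points
-- y, z of B i₀ the blocks through y and z form a σ-invariant set of λ < p
-- blocks, so each is σ-fixed.  Because λ ≥ 2, every block other than B i₀
-- meets B i₀ in two distinct points, and B i₀ itself has k > λ ≥ 2 points;
-- hence σ fixes every block.  Then every block through a point x also
-- passes through α x, so α x ≠ x would give k ≤ λ.  Thus α = id,
-- contradicting that α has order p > 1.

open import Defs
open import Data.Nat using (ℕ; _<_)
open import Data.Nat.Primality using (Prime)
open import Data.Fin using (Fin)
open import Data.Fin.Subset using (Subset)
open import Relation.Nullary using (¬_)

open import Data.Nat using (zero; suc; _+_; _*_; _∸_; _≤_; z<s; s≤s; >-nonZero)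
open import Data.Nat.Base using (nonTrivial⇒n>1)
open import Data.Nat.Properties
  using (<⇒≤; <⇒≱; ≤-reflexive; <-trans; <-≤-trans; m≤m+n; m∸n+n≡m; m<n⇒0<n∸m; +-monoʳ-<; module ≤-Reasoning)
open import Data.Nat.Coprimality using (Coprime; coprime-Bézout)
open import Data.Nat.GCD using (module Bézout)
open import Data.Nat.Divisibility using (>⇒∤)
open import Data.Nat.Primality using (prime⇒irreducible; prime⇒nonTrivial)
open import Data.Fin using (toℕ) renaming (zero to fzero; suc to fsuc; _<_ to _<ᶠ_)
open import Data.Fin.Properties using (pigeonhole; toℕ<n) renaming (suc-injective to fsuc-injective; _≟_ to _≟ᶠ_)
open import Data.Fin.Subset using (_∈_; _∩_; ∣_∣; _⊆_; inside; outside)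
open import Data.Fin.Subset.Properties using (_∈?_; ⊆-antisym; x∈p∩q⁻)
open import Data.Vec using (_∷_; here; there)
open import Data.List using (List; filter; length; allFin; lookup)
open import Data.List.Membership.Propositional using () renaming (_∈_ to _∈ˡ_)
open import Data.List.Membership.Propositional.Properties using (∈-filter⁺; ∈-allFin)
open import Data.List.Relation.Unary.Any using (index)
open import Data.List.Relation.Unary.Any.Properties using (lookup-index)
open import Data.List.Relation.Binary.Sublist.Propositional using (⊆-refl)
open import Data.List.Relation.Binary.Sublist.Propositional.Properties using (filter⁺; length-mono-≤)
open import Data.Product using (∃; ∃₂; _×_; _,_; proj₁; proj₂)
open import Data.Sum using (inj₁; inj₂)
open import Function using (_∘_; _⇔_; Equivalence)
open import Function.Definitions using (Injective)
open import Function.Properties.Equivalence using () renaming (refl to ⇔-refl; trans to ⇔-trans)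
open import Relation.Binary.PropositionalEquality
  using (_≡_; _≢_; refl; sym; trans; cong; subst; module ≡-Reasoning)
open import Relation.Nullary using (yes; no; contradiction)
open import Relation.Nullary.Decidable using (_×-dec_)
open import Relation.Unary using (Decidable)

iter-+ : ∀ {A : Set} m n (f : A → A) x → iter (m + n) f x ≡ iter m f (iter n f x)
iter-+ zero    n f x = refl
iter-+ (suc m) n f x = cong f (iter-+ m n f x)
coprime-to-prime : ∀ {p e} → Prime p → 0 < e → e < p → Coprime e p
coprime-to-prime pr 0<e e<p (d∣e , d∣p) with prime⇒irreducible pr d∣p
... | inj₁ d≡1 = d≡1
... | inj₂ refl = contradiction d∣e (>⇒∤ {{>-nonZero 0<e}} e<p)

module Periodicity {A : Set} (f : A → A) where

  Periodic : ℕ → A → Set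
  Periodic n x = iter n f x ≡ x

  periodic-* : ∀ {n x} q → Periodic n x → Periodic (q * n) x
  periodic-* zero    px = refl
  periodic-* {n} {x} (suc q) px = begin
    iter (n + q * n) f x         ≡⟨ iter-+ n (q * n) f x ⟩
    iter n f (iter (q * n) f x)  ≡⟨ cong (iter n f) (periodic-* q px) ⟩
    iter n f x                   ≡⟨ px ⟩
    x                            ∎
    where open ≡-Reasoning

  fixed-by-Bézout : ∀ {m n x} a b → Periodic m x → Periodic n x →
                    1 + a * m ≡ b * n → f x ≡ x
  fixed-by-Bézout {m} {n} {x} a b pm pn eq = begin
    f x                    ≡⟨ cong f (periodic-* a pm) ⟨
    iter (1 + a * m) f x   ≡⟨ cong (λ k → iter k f x) eq ⟩
    iter (b * n) f x       ≡⟨ periodic-* b pn ⟩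
    x                      ∎
    where open ≡-Reasoning

  prime-period⇒fixed : ∀ {p e x} → Prime p → Periodic p x → Periodic e x →
                       0 < e → e < p → f x ≡ x
  prime-period⇒fixed pr pp pe 0<e e<p with coprime-Bézout (coprime-to-prime pr 0<e e<p)
  ... | Bézout.+- a b eq = fixed-by-Bézout b a pp pe eq
  ... | Bézout.-+ a b eq = fixed-by-Bézout a b pe pp eq

  repetition⇒period : ∀ {p a b x} → Periodic p x → a < b → b < p →
                      iter a f x ≡ iter b f x →
                      Periodic ((p ∸ b) + a) x × 0 < (p ∸ b) + a × (p ∸ b) + a < p
  repetition⇒period {p} {a} {b} {x} pp a<b b<p repeat = period , positive , below
    where
    p∸b+b≡p : (p ∸ b) + b ≡ p
    p∸b+b≡p = m∸n+n≡m (<⇒≤ b<p)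
    period : Periodic ((p ∸ b) + a) x
    period = begin
      iter ((p ∸ b) + a) f x       ≡⟨ iter-+ (p ∸ b) a f x ⟩
      iter (p ∸ b) f (iter a f x)  ≡⟨ cong (iter (p ∸ b) f) repeat ⟩
      iter (p ∸ b) f (iter b f x)  ≡⟨ iter-+ (p ∸ b) b f x ⟨
      iter ((p ∸ b) + b) f x       ≡⟨ cong (λ k → iter k f x) p∸b+b≡p ⟩
      iter p f x                   ≡⟨ pp ⟩
      x                            ∎
      where open ≡-Reasoning
    positive : 0 < (p ∸ b) + a
    positive = <-≤-trans (m<n⇒0<n∸m b<p) (m≤m+n (p ∸ b) a)
    below : (p ∸ b) + a < p
    below = <-≤-trans (+-monoʳ-< (p ∸ b) a<b) (≤-reflexive p∸b+b≡p)

  -- Orbits of prime period are either trivial or have p distinct points: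
  -- if the whole orbit of a point of prime period p lies in a list of
  -- fewer than p elements, the point is fixed.
  short-orbit⇒fixed : ∀ {p x} → Prime p → Periodic p x → (xs : List A) →
                      (∀ m → iter m f x ∈ˡ xs) → length xs < p → f x ≡ x
  short-orbit⇒fixed {p} {x} pr pp xs orbit⊆xs short =
    from-collision (pigeonhole short slot)
    where
    slot : Fin p → Fin (length xs)
    slot a = index (orbit⊆xs (toℕ a))

    from-collision : ∃₂ (λ i j → i <ᶠ j × slot i ≡ slot j) → f x ≡ x
    from-collision (i , j , i<j , same-slot) =
      let period , positive , below = repetition⇒period pp i<j (toℕ<n j) repeat
      in  prime-period⇒fixed pr pp period positive below
      where
      repeat : iter (toℕ i) f x ≡ iter (toℕ j) f x
      repeat = begin
        iter (toℕ i) f x              ≡⟨ lookup-index (orbit⊆xs (toℕ i)) ⟩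
        lookup xs (slot i)            ≡⟨ cong (lookup xs) same-slot ⟩
        lookup xs (slot j)            ≡⟨ lookup-index (orbit⊆xs (toℕ j)) ⟨
        iter (toℕ j) f x              ∎
        where open ≡-Reasoning

some-member : ∀ {n} (S : Subset n) → 1 ≤ ∣ S ∣ → ∃ λ y → y ∈ S
some-member (inside  ∷ S) _ = fzero , here
some-member (outside ∷ S) h with y , y∈S ← some-member S h = fsuc y , there y∈S

two-members : ∀ {n} (S : Subset n) → 2 ≤ ∣ S ∣ → ∃₂ λ y z → y ≢ z × y ∈ S × z ∈ S
two-members (inside ∷ S) (s≤s h) with z , z∈S ← some-member S h =
  fzero , fsuc z , (λ ()) , here , there z∈S
two-members (outside ∷ S) h with y , z , y≢z , y∈S , z∈S ← two-members S h =
  fsuc y , fsuc z , y≢z ∘ fsuc-injective , there y∈S , there z∈S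

count-mono : ∀ {A : Set} {P Q : A → Set} (P? : Decidable P) (Q? : Decidable Q) →
             (∀ a → P a → Q a) → (xs : List A) →
             length (filter P? xs) ≤ length (filter Q? xs)
count-mono P? Q? P⇒Q xs = length-mono-≤ (filter⁺ P? Q? (λ { refl → P⇒Q _ }) (⊆-refl {x = xs}))

module InducedPermutation {v : ℕ} (B : Fin v → Subset v) (α : Fin v → Fin v)
  (maps-blocks : ∀ i → ∃ λ j → ∀ y → (y ∈ B i ⇔ α y ∈ B j)) where

  σ : Fin v → Fin v
  σ i = proj₁ (maps-blocks i)

  transport : ∀ m i y → y ∈ B i ⇔ iter m α y ∈ B (iter m σ i)
  transport zero    i y = ⇔-refl
  transport (suc m) i y = ⇔-trans (transport m i y) (proj₂ (maps-blocks (iter m σ i)) (iter m α y))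

  fixed-point-stays : ∀ {y i} → α y ≡ y → y ∈ B i → ∀ m → y ∈ B (iter m σ i)
  fixed-point-stays {y} {i} αy≡y y∈Bi m =
    subst (_∈ B (iter m σ i)) (α^m-fixes m) (Equivalence.to (transport m i y) y∈Bi)
    where
    α^m-fixes : ∀ m → iter m α y ≡ y
    α^m-fixes zero    = refl
    α^m-fixes (suc m) = trans (cong α (α^m-fixes m)) αy≡y

  fixed-block-preserved : ∀ {c y} → σ c ≡ c → y ∈ B c → α y ∈ B c
  fixed-block-preserved {c} {y} σc≡c y∈Bc =
    subst (λ j → α y ∈ B j) σc≡c (Equivalence.to (proj₂ (maps-blocks c) y) y∈Bc)

  induced-period : Injective _≡_ _≡_ B → ∀ {p} → (∀ x → iter p α x ≡ x) →
                   ∀ i → iter p σ i ≡ i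
  induced-period B-injective {p} α^p≡id i = B-injective (⊆-antisym ⊆Bi Bi⊆)
    where
    ⊆Bi : B (iter p σ i) ⊆ B i
    ⊆Bi {y} h = Equivalence.from (transport p i y) (subst (_∈ B (iter p σ i)) (sym (α^p≡id y)) h)
    Bi⊆ : B i ⊆ B (iter p σ i)
    Bi⊆ {y} h = subst (_∈ B (iter p σ i)) (α^p≡id y) (Equivalence.to (transport p i y) h)

module PrimeOrderAutomorphism
  {v k lam : ℕ} {B : Fin v → Subset v} (D : IsSymmetricDesign v k lam B)
  {α : Fin v → Fin v} (maps-blocks : ∀ i → ∃ λ j → ∀ y → (y ∈ B i ⇔ α y ∈ B j))
  {p : ℕ} (p-prime : Prime p) (α^p≡id : ∀ x → iter p α x ≡ x) (lam<p : lam < p)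
  where

  open IsSymmetricDesign D
  open InducedPermutation B α maps-blocks
  open Periodicity σ using (short-orbit⇒fixed)

  -- The blocks through two distinct α-fixed points form a σ-invariant set
  -- of only λ < p blocks, so each of them is fixed by σ.
  block-through-fixed-pair-is-fixed : ∀ {y z} → y ≢ z → α y ≡ y → α z ≡ z →
                                      ∀ c → y ∈ B c → z ∈ B c → σ c ≡ c
  block-through-fixed-pair-is-fixed {y} {z} y≢z αy≡y αz≡z c y∈Bc z∈Bc =
    short-orbit⇒fixed p-prime (induced-period blocks-distinct {p} α^p≡id c)
      (filter through-both? (allFin v)) orbit-through-both
      (subst (_< p) (sym (pair-count y z y≢z)) lam<p)
    where
    through-both? : Decidable (λ j → y ∈ B j × z ∈ B j)
    through-both? j = (y ∈? B j) ×-dec (z ∈? B j)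
    orbit-through-both : ∀ m → iter m σ c ∈ˡ filter through-both? (allFin v)
    orbit-through-both m = ∈-filter⁺ through-both? (∈-allFin _)
      (fixed-point-stays αy≡y y∈Bc m , fixed-point-stays αz≡z z∈Bc m)

  -- If some block B i₀ is fixed pointwise and λ ≥ 2, then σ fixes every
  -- block: B i₀ has k > λ ≥ 2 points, and any other block meets it in λ ≥ 2.
  pointwise-fixed-block⇒blocks-fixed : 1 < lam → ∀ i₀ → BlockFixedPointwise α (B i₀) →
                                       ∀ c → σ c ≡ c
  pointwise-fixed-block⇒blocks-fixed 1<lam i₀ fixed c with c ≟ᶠ i₀
  ... | yes refl
    with y , z , y≢z , y∈B , z∈B ← two-members (B c) (subst (2 ≤_) (sym (block-size c)) (<-trans 1<lam lam<k))
    = block-through-fixed-pair-is-fixed y≢z (fixed y y∈B) (fixed z z∈B) c y∈B z∈B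
  ... | no c≢i₀
    with y , z , y≢z , y∈∩ , z∈∩ ← two-members (B c ∩ B i₀) (subst (2 ≤_) (sym (block-inter c i₀ c≢i₀)) 1<lam)
    with y∈Bc , y∈Bi₀ ← x∈p∩q⁻ (B c) (B i₀) y∈∩
    with z∈Bc , z∈Bi₀ ← x∈p∩q⁻ (B c) (B i₀) z∈∩
    = block-through-fixed-pair-is-fixed y≢z (fixed y y∈Bi₀) (fixed z z∈Bi₀) c y∈Bc z∈Bc

-- If α fixes every block, α is the identity: otherwise every one of the k
-- blocks through x would also pass through α x ≠ x, giving k ≤ λ.
blocks-fixed⇒identity : ∀ {v k lam} {B : Fin v → Subset v} → IsSymmetricDesign v k lam B →
                        ∀ {α : Fin v → Fin v} → (∀ i → ∀ y → y ∈ B i → α y ∈ B i) →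
                        ∀ x → α x ≡ x
blocks-fixed⇒identity {v} {k} {lam} {B} D {α} preserves x with α x ≟ᶠ x
... | yes αx≡x = αx≡x
... | no  αx≢x = contradiction k≤lam (<⇒≱ lam<k)
  where
  open IsSymmetricDesign D
  k≤lam : k ≤ lam
  k≤lam = begin
    k                             ≡⟨ replication x ⟨
    blocksThrough₁ B x            ≤⟨ count-mono (λ c → x ∈? B c) (λ c → (x ∈? B c) ×-dec (α x ∈? B c))
                                       (λ c x∈Bc → x∈Bc , preserves c x x∈Bc) (allFin v) ⟩
    blocksThrough B x (α x)       ≡⟨ pair-count x (α x) (αx≢x ∘ sym) ⟩
    lam                           ∎
    where open ≤-Reasoning

lemma2p6 : (v k lam p : ℕ) (B : Fin v → Subset v) (α : Fin v → Fin v) →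
    IsSymmetricDesign v k lam B → IsAutomorphism B α →
    Prime p → HasOrder α p → 1 < lam → lam < p →
    ∀ i → ¬ BlockFixedPointwise α (B i)
lemma2p6 v k lam p B α D (_ , maps-blocks) p-prime (α^p≡id , order-minimal) 1<lam lam<p i₀ fixed =
  order-minimal 1 z<s (nonTrivial⇒n>1 p {{prime⇒nonTrivial p-prime}}) α-is-identity
  where
  open InducedPermutation B α maps-blocks using (σ; fixed-block-preserved)
  open PrimeOrderAutomorphism D maps-blocks p-prime α^p≡id lam<p

  σ-is-identity : ∀ c → σ c ≡ c
  σ-is-identity = pointwise-fixed-block⇒blocks-fixed 1<lam i₀ fixed

  α-preserves-blocks : ∀ c y → y ∈ B c → α y ∈ B c
  α-preserves-blocks c y = fixed-block-preserved (σ-is-identity c)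

  α-is-identity : ∀ x → α x ≡ x
  α-is-identity = blocks-fixed⇒identity D α-preserves-blocks
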